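{- Let $\{a_l\}_{l\ge0}$ be a sequence of complex numbers and let $a_l^*=\sum_{j=0}^l\binom lj(-1)^ja_j$ for $l\ge0$. For $k\ge0$ set $$A_k(u)=\sum_{l=0}^k\binom kl(-1)^la_lu^{k-l},\qquad A_k^*(u)=\sum_{l=0}^k\binom kl(-1)^la_l^*u^{k-l}.$$ Let $n$ be a positive integer, and let $r,s,t,x,y,z$ be complex numbers with $r+s+t=n-1$ and $x+y+z=1$. Then $$\sum_{k=0}^n(-1)^k\binom rkx^{n-k}\left(\binom {s}{n-k}A_k(y)-(-1)^n\binom t{n-k}A_k^*(z)\right)=0.$$
   Context: For complex $w$ and integer $k\ge0$, $\binom wk=w(w-1)\cdots(w-k+1)/k!$ (with $\binom w0=1$). -}

module Defs where

open import Level using (_⊔_)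
open import Data.Nat using (ℕ; zero; suc; _!)
open import Algebra.Bundles using (CommutativeRing)

module _ {c ℓ} (R : CommutativeRing c ℓ) where
  open CommutativeRing R

  fromℕ : ℕ → Carrier
  fromℕ zero    = 0#
  fromℕ (suc n) = 1# + fromℕ n

  pow : Carrier → ℕ → Carrier
  pow u zero    = 1#
  pow u (suc k) = pow u k * u

  sgn : ℕ → Carrier
  sgn zero    = 1#
  sgn (suc l) = - sgn l

  falling : Carrier → ℕ → Carrier
  falling w zero    = 1#
  falling w (suc k) = falling w k * (w - fromℕ k)

  sumTo : ℕ → (ℕ → Carrier) → Carrier
  sumTo zero    f = f 0
  sumTo (suc k) f = sumTo k f + f (suc k)

  -- R contains inverses of all factorials (k! · 1 is invertible),
  -- i.e. R is a ℚ-algebra; this is what is needed to define binom w k.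
  record FactorialInverses : Set (c ⊔ ℓ) where
    field
      inv         : ℕ → Carrier
      inv-correct : ∀ k → inv k * fromℕ (k !) ≈ 1#

module _ {c ℓ} (R : CommutativeRing c ℓ) (F : FactorialInverses R) where
  open CommutativeRing R
  open FactorialInverses F

  binom : Carrier → ℕ → Carrier
  binom w k = falling R w k * inv k

  aStar : (ℕ → Carrier) → ℕ → Carrier
  aStar a l = sumTo R l (λ j → binom (fromℕ R l) j * sgn R j * a j)

  Apoly : (ℕ → Carrier) → ℕ → Carrier → Carrier
  Apoly a k u = sumTo R k (λ l → binom (fromℕ R k) l * sgn R l * a l * pow R u (k Data.Nat.∸ l))

  AStarPoly : (ℕ → Carrier) → ℕ → Carrier → Carrier
  AStarPoly a k u = Apoly (aStar a) k u

{-# OPTIONS --safe #-}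
-- With E the shift of a sequence, the signed sequences p_m = (-1)^m A_m(y) and
-- q_m = (-1)^m A*_m(z) obey p_{m+1} = -y p_m + (E p)_m and, since 1 - z = x + y,
-- q_{m+1} = (x + y) q_m - (E q)_m, with p_0 = q_0 = a_0. The sum is
-- B_n(r,s,p) - (-1)^n B_n(r,t,q), where B_n(r,s,h) = Σ_{m+j=n} C(r,m) h_m C(s,j) x^j,
-- and B_n(r,s,p) = (-1)^n B_n(r,t,q) for r + s + t = n - 1 is proved by induction on n
-- for all r, s, t and all sequences at once. Multiplied by n + 1, the Leibniz rule and
-- (k+1) C(w,k+1) = w C(w-1,k) express both sides through B_n with r, s or t lowered by one,
-- to which the induction hypothesis applies; after substituting s = n - r - t the
-- difference is x (n B_n - r (B_n - B_n(r-1)) - t (B_n - B_n(t-1))), which vanishes by the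
-- same Leibniz computation combined with Pascal's rule. Finally n + 1 is cancelled using
-- the inverse factorials.
module Submission where

open import Defs
open import Data.Nat using (ℕ; _≥_; _∸_)
open import Algebra.Bundles using (CommutativeRing)
open import Data.Nat as ℕ using (zero; suc; _!; _≤_; z≤n)
import Data.Nat.Properties as ℕₚ
open import Data.Integer as ℤ using (ℤ; +_; -[1+_])
import Data.Integer.Properties as ℤₚ
open import Data.Sign as Sign using (Sign)
open import Data.Maybe using (Maybe; nothing; just)
open import Function using (_∘_)
open import Relation.Nullary using (yes; no)
open import Relation.Binary.PropositionalEquality as ≡ using (_≡_)
open import Algebra.Solver.Ring.AlmostCommutativeRing using (fromCommutativeRing; _-Raw-AlmostCommutative⟶_)

module IntegerCoefficients {c ℓ} (R : CommutativeRing c ℓ) where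
  open CommutativeRing R
  open import Algebra.Properties.Ring ring using (-0#≈0#; -‿involutive; -‿+-comm; -1*x≈-x)
  open import Algebra.Properties.Semiring.Mult.TCOptimised semiring using (_×_; 1+×; ×-homo-+; ×1-homo-*)
  open import Algebra.Properties.CommutativeSemigroup *-commutativeSemigroup using () renaming (interchange to *-interchange)
  open import Algebra.Properties.CommutativeSemigroup +-commutativeSemigroup using () renaming (interchange to +-interchange)
  open import Relation.Binary.Reasoning.Setoid setoid

  fromℕ≈×1# : ∀ n → fromℕ R n ≈ n × 1#
  fromℕ≈×1# zero    = refl
  fromℕ≈×1# (suc n) = trans (+-cong refl (fromℕ≈×1# n)) (sym (1+× n 1#))

  fromℕ-* : ∀ m n → fromℕ R (m ℕ.* n) ≈ fromℕ R m * fromℕ R n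
  fromℕ-* m n = begin
    fromℕ R (m ℕ.* n)      ≈⟨ fromℕ≈×1# (m ℕ.* n) ⟩
    (m ℕ.* n) × 1#         ≈⟨ ×1-homo-* m n ⟩
    (m × 1#) * (n × 1#)    ≈⟨ *-cong (fromℕ≈×1# m) (fromℕ≈×1# n) ⟨
    fromℕ R m * fromℕ R n  ∎

  -- The optimised multiple _×_ sends 1 to 1# definitionally, so that the
  -- solver's constant 1 can be matched against 1# in goals.
  fromℤ : ℤ → Carrier
  fromℤ (+ n)    = n × 1#
  fromℤ -[1+ n ] = - (suc n × 1#)

  fromSign : Sign → Carrier
  fromSign Sign.+ = 1#
  fromSign Sign.- = - 1#

  fromSign-* : ∀ s t → fromSign (s Sign.* t) ≈ fromSign s * fromSign t
  fromSign-* Sign.+ Sign.+ = sym (*-identityˡ 1#)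
  fromSign-* Sign.+ Sign.- = sym (*-identityˡ (- 1#))
  fromSign-* Sign.- Sign.+ = sym (*-identityʳ (- 1#))
  fromSign-* Sign.- Sign.- = sym (trans (-1*x≈-x (- 1#)) (-‿involutive 1#))

  fromℤ-◃ : ∀ s n → fromℤ (s ℤ.◃ n) ≈ fromSign s * (n × 1#)
  fromℤ-◃ s      zero    = sym (zeroʳ (fromSign s))
  fromℤ-◃ Sign.+ (suc n) = sym (*-identityˡ _)
  fromℤ-◃ Sign.- (suc n) = sym (-1*x≈-x _)

  fromℤ≈sign*abs : ∀ i → fromℤ i ≈ fromSign (ℤ.sign i) * (ℤ.∣ i ∣ × 1#)
  fromℤ≈sign*abs (+ n)    = sym (*-identityˡ _)
  fromℤ≈sign*abs -[1+ n ] = sym (-1*x≈-x _)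

  fromℤ-* : ∀ i j → fromℤ (i ℤ.* j) ≈ fromℤ i * fromℤ j
  fromℤ-* i j = begin
    fromℤ (i ℤ.* j)
      ≈⟨ fromℤ-◃ (ℤ.sign i Sign.* ℤ.sign j) (ℤ.∣ i ∣ ℕ.* ℤ.∣ j ∣) ⟩
    fromSign (ℤ.sign i Sign.* ℤ.sign j) * ((ℤ.∣ i ∣ ℕ.* ℤ.∣ j ∣) × 1#)
      ≈⟨ *-cong (fromSign-* (ℤ.sign i) (ℤ.sign j)) (×1-homo-* ℤ.∣ i ∣ ℤ.∣ j ∣) ⟩
    (fromSign (ℤ.sign i) * fromSign (ℤ.sign j)) * ((ℤ.∣ i ∣ × 1#) * (ℤ.∣ j ∣ × 1#))
      ≈⟨ *-interchange _ _ _ _ ⟩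
    (fromSign (ℤ.sign i) * (ℤ.∣ i ∣ × 1#)) * (fromSign (ℤ.sign j) * (ℤ.∣ j ∣ × 1#))
      ≈⟨ *-cong (fromℤ≈sign*abs i) (fromℤ≈sign*abs j) ⟨
    fromℤ i * fromℤ j ∎

  +-cancel-common : ∀ o u v → (o + u) - (o + v) ≈ u - v
  +-cancel-common o u v = begin
    (o + u) - (o + v)      ≈⟨ +-cong refl (-‿+-comm o v) ⟨
    (o + u) + (- o + - v)  ≈⟨ +-interchange o u (- o) (- v) ⟩
    (o - o) + (u - v)      ≈⟨ +-cong (-‿inverseʳ o) refl ⟩
    0# + (u - v)           ≈⟨ +-identityˡ _ ⟩
    u - v                  ∎

  fromℤ-⊖ : ∀ m n → fromℤ (m ℤ.⊖ n) ≈ m × 1# - n × 1#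
  fromℤ-⊖ m       zero    = sym (trans (+-cong refl -0#≈0#) (+-identityʳ _))
  fromℤ-⊖ zero    (suc n) = sym (+-identityˡ _)
  fromℤ-⊖ (suc m) (suc n) = begin
    fromℤ (suc m ℤ.⊖ suc n)          ≈⟨ reflexive (≡.cong fromℤ (ℤₚ.[1+m]⊖[1+n]≡m⊖n m n)) ⟩
    fromℤ (m ℤ.⊖ n)                  ≈⟨ fromℤ-⊖ m n ⟩
    m × 1# - n × 1#                  ≈⟨ +-cancel-common 1# (m × 1#) (n × 1#) ⟨
    (1# + m × 1#) - (1# + n × 1#)    ≈⟨ +-cong (1+× m 1#) (-‿cong (1+× n 1#)) ⟨
    suc m × 1# - suc n × 1#          ∎

  fromℤ-+ : ∀ i j → fromℤ (i ℤ.+ j) ≈ fromℤ i + fromℤ j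
  fromℤ-+ (+ m)    (+ n)    = ×-homo-+ 1# m n
  fromℤ-+ (+ m)    -[1+ n ] = fromℤ-⊖ m (suc n)
  fromℤ-+ -[1+ m ] (+ n)    = trans (fromℤ-⊖ n (suc m)) (+-comm _ _)
  fromℤ-+ -[1+ m ] -[1+ n ] = begin
    - (suc (suc (m ℕ.+ n)) × 1#)      ≈⟨ -‿cong (reflexive (≡.cong (λ k → suc k × 1#) (ℕₚ.+-suc m n))) ⟨
    - ((suc m ℕ.+ suc n) × 1#)        ≈⟨ -‿cong (×-homo-+ 1# (suc m) (suc n)) ⟩
    - (suc m × 1# + suc n × 1#)       ≈⟨ -‿+-comm _ _ ⟨
    - (suc m × 1#) + - (suc n × 1#)   ∎

  fromℤ-neg : ∀ i → fromℤ (ℤ.- i) ≈ - fromℤ i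
  fromℤ-neg (+ zero)  = sym -0#≈0#
  fromℤ-neg (+ suc n) = refl
  fromℤ-neg -[1+ n ]  = sym (-‿involutive _)

  ℤ-morphism : ℤ.+-*-rawRing -Raw-AlmostCommutative⟶ fromCommutativeRing R
  ℤ-morphism = record
    { ⟦_⟧    = fromℤ
    ; +-homo = fromℤ-+
    ; *-homo = fromℤ-*
    ; -‿homo = fromℤ-neg
    ; 0-homo = refl
    ; 1-homo = refl
    }

  fromℤ-≟ : ∀ i j → Maybe (fromℤ i ≈ fromℤ j)
  fromℤ-≟ i j with i ℤ.≟ j
  ... | yes i≡j = just (reflexive (≡.cong fromℤ i≡j))
  ... | no _    = nothing

  open import Algebra.Solver.Ring ℤ.+-*-rawRing (fromCommutativeRing R) ℤ-morphism fromℤ-≟ public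
    using (solve; _:=_; _:+_; _:*_; :-_; _:-_; con)

module Convolution {c ℓ} (R : CommutativeRing c ℓ) where
  open CommutativeRing R
  open IntegerCoefficients R using (solve; _:=_; _:+_; _:*_; :-_; _:-_; con)
  open import Algebra.Properties.Ring ring using (-‿distribˡ-*; -‿+-comm)
  open import Algebra.Properties.CommutativeSemigroup +-commutativeSemigroup using () renaming (interchange to +-interchange)
  open import Algebra.Properties.CommutativeSemigroup *-commutativeSemigroup using (x∙yz≈y∙xz)
  open import Relation.Binary.Reasoning.Setoid setoid

  sumTo-congᵇ : ∀ N {f g} → (∀ k → k ≤ N → f k ≈ g k) → sumTo R N f ≈ sumTo R N g
  sumTo-congᵇ zero    f≈g = f≈g 0 z≤n
  sumTo-congᵇ (suc N) f≈g = +-cong (sumTo-congᵇ N (λ k k≤N → f≈g k (ℕₚ.m≤n⇒m≤1+n k≤N))) (f≈g (suc N) ℕₚ.≤-refl)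

  sumTo-cong : ∀ N {f g} → (∀ k → f k ≈ g k) → sumTo R N f ≈ sumTo R N g
  sumTo-cong N f≈g = sumTo-congᵇ N (λ k _ → f≈g k)

  sumTo-+ : ∀ N f g → sumTo R N (λ k → f k + g k) ≈ sumTo R N f + sumTo R N g
  sumTo-+ zero    f g = refl
  sumTo-+ (suc N) f g = trans (+-cong (sumTo-+ N f g) refl) (+-interchange _ _ _ _)

  sumTo-*ˡ : ∀ N α f → sumTo R N (λ k → α * f k) ≈ α * sumTo R N f
  sumTo-*ˡ zero    α f = refl
  sumTo-*ˡ (suc N) α f = trans (+-cong (sumTo-*ˡ N α f) refl) (sym (distribˡ α _ _))

  conv : ℕ → (ℕ → Carrier) → (ℕ → Carrier) → Carrier
  conv zero    f g = f 0 * g 0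
  conv (suc N) f g = f 0 * g (suc N) + conv N (f ∘ suc) g

  conv-cong : ∀ N {f f′ g g′} → (∀ i → f i ≈ f′ i) → (∀ j → g j ≈ g′ j) → conv N f g ≈ conv N f′ g′
  conv-cong zero    f≈f′ g≈g′ = *-cong (f≈f′ 0) (g≈g′ 0)
  conv-cong (suc N) f≈f′ g≈g′ = +-cong (*-cong (f≈f′ 0) (g≈g′ (suc N))) (conv-cong N (f≈f′ ∘ suc) g≈g′)

  conv-congˡ : ∀ N {f f′} g → (∀ i → f i ≈ f′ i) → conv N f g ≈ conv N f′ g
  conv-congˡ N g f≈f′ = conv-cong N f≈f′ (λ _ → refl)

  conv-congʳ : ∀ N f {g g′} → (∀ j → g j ≈ g′ j) → conv N f g ≈ conv N f g′
  conv-congʳ N f g≈g′ = conv-cong N (λ _ → refl) g≈g′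

  conv-+ˡ : ∀ N f h g → conv N (λ i → f i + h i) g ≈ conv N f g + conv N h g
  conv-+ˡ zero    f h g = distribʳ _ _ _
  conv-+ˡ (suc N) f h g = trans (+-cong (distribʳ _ _ _) (conv-+ˡ N (f ∘ suc) (h ∘ suc) g)) (+-interchange _ _ _ _)

  conv-+ʳ : ∀ N f g h → conv N f (λ j → g j + h j) ≈ conv N f g + conv N f h
  conv-+ʳ zero    f g h = distribˡ _ _ _
  conv-+ʳ (suc N) f g h = trans (+-cong (distribˡ _ _ _) (conv-+ʳ N (f ∘ suc) g h)) (+-interchange _ _ _ _)

  conv-*ˡ : ∀ N α f g → conv N (λ i → α * f i) g ≈ α * conv N f g
  conv-*ˡ zero    α f g = *-assoc _ _ _
  conv-*ˡ (suc N) α f g = trans (+-cong (*-assoc _ _ _) (conv-*ˡ N α (f ∘ suc) g)) (sym (distribˡ _ _ _))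

  conv-*ʳ : ∀ N α f g → conv N f (λ j → α * g j) ≈ α * conv N f g
  conv-*ʳ zero    α f g = x∙yz≈y∙xz _ _ _
  conv-*ʳ (suc N) α f g = trans (+-cong (x∙yz≈y∙xz _ _ _) (conv-*ʳ N α (f ∘ suc) g)) (sym (distribˡ _ _ _))

  conv-negˡ : ∀ N f g → conv N (λ i → - f i) g ≈ - conv N f g
  conv-negˡ zero    f g = sym (-‿distribˡ-* _ _)
  conv-negˡ (suc N) f g = trans (+-cong (sym (-‿distribˡ-* _ _)) (conv-negˡ N (f ∘ suc) g)) (-‿+-comm _ _)

  conv-sucʳ : ∀ N f g → conv (suc N) f g ≈ conv N f (g ∘ suc) + f (suc N) * g 0
  conv-sucʳ zero    f g = refl
  conv-sucʳ (suc N) f g = trans (+-cong refl (conv-sucʳ N (f ∘ suc) g)) (sym (+-assoc _ _ _))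

  conv-splitˡ : ∀ N {f f′ h} g → f 0 ≈ f′ 0 → (∀ i → f (suc i) ≈ f′ (suc i) + h i) →
                conv (suc N) f g ≈ conv (suc N) f′ g + conv N h g
  conv-splitˡ N {f} {f′} {h} g f₀≈f′₀ f≈f′+h = begin
    f 0 * g (suc N) + conv N (f ∘ suc) g                         ≈⟨ +-cong (*-cong f₀≈f′₀ refl) (conv-congˡ N g f≈f′+h) ⟩
    f′ 0 * g (suc N) + conv N (λ i → f′ (suc i) + h i) g         ≈⟨ +-cong refl (conv-+ˡ N (f′ ∘ suc) h g) ⟩
    f′ 0 * g (suc N) + (conv N (f′ ∘ suc) g + conv N h g)        ≈⟨ +-assoc _ _ _ ⟨
    conv (suc N) f′ g + conv N h g                               ∎

  conv-splitʳ : ∀ N f {g g′ h} → g 0 ≈ g′ 0 → (∀ j → g (suc j) ≈ g′ (suc j) + h j) →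
                conv (suc N) f g ≈ conv (suc N) f g′ + conv N f h
  conv-splitʳ N f {g} {g′} {h} g₀≈g′₀ g≈g′+h = begin
    conv (suc N) f g                                             ≈⟨ conv-sucʳ N f g ⟩
    conv N f (g ∘ suc) + f (suc N) * g 0                         ≈⟨ +-cong (conv-congʳ N f g≈g′+h) (*-cong refl g₀≈g′₀) ⟩
    conv N f (λ j → g′ (suc j) + h j) + f (suc N) * g′ 0         ≈⟨ +-cong (conv-+ʳ N f (g′ ∘ suc) h) refl ⟩
    conv N f (g′ ∘ suc) + conv N f h + f (suc N) * g′ 0
      ≈⟨ solve 3 (λ a b c → a :+ b :+ c := a :+ c :+ b) refl (conv N f (g′ ∘ suc)) (conv N f h) (f (suc N) * g′ 0) ⟩
    conv N f (g′ ∘ suc) + f (suc N) * g′ 0 + conv N f h          ≈⟨ +-cong (conv-sucʳ N f g′) refl ⟨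
    conv (suc N) f g′ + conv N f h                               ∎

  conv-leibniz : ∀ N f g →
    fromℕ R N * conv N f g ≈ conv N (λ i → fromℕ R i * f i) g + conv N f (λ j → fromℕ R j * g j)
  conv-leibniz zero    f g = solve 2 (λ a b → con (+ 0) :* (a :* b) := con (+ 0) :* a :* b :+ a :* (con (+ 0) :* b)) refl (f 0) (g 0)
  conv-leibniz (suc N) f g = begin
    (1# + n) * (f 0 * g (suc N) + cv)
      ≈⟨ solve 4 (λ n a b cv → (con (+ 1) :+ n) :* (a :* b :+ cv) := a :* (con (+ 1) :+ n) :* b :+ cv :+ n :* cv) refl n (f 0) (g (suc N)) cv ⟩
    f 0 * (1# + n) * g (suc N) + cv + n * cv                     ≈⟨ +-cong refl (conv-leibniz N (f ∘ suc) g) ⟩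
    f 0 * (1# + n) * g (suc N) + cv + (A + B)
      ≈⟨ solve 6 (λ a m b cv A B′ → a :* m :* b :+ cv :+ (A :+ B′) := con (+ 0) :* a :* b :+ (cv :+ A) :+ (a :* (m :* b) :+ B′)) refl (f 0) (1# + n) (g (suc N)) cv A B ⟩
    0# * f 0 * g (suc N) + (cv + A) + (f 0 * ((1# + n) * g (suc N)) + B)
      ≈⟨ +-cong (+-cong refl (conv-+ˡ N (f ∘ suc) (λ i → fromℕ R i * f (suc i)) g)) refl ⟨
    0# * f 0 * g (suc N) + conv N (λ i → f (suc i) + fromℕ R i * f (suc i)) g + (f 0 * ((1# + n) * g (suc N)) + B)
      ≈⟨ +-cong (+-cong refl (conv-congˡ N g (λ i → solve 2 (λ m a → a :+ m :* a := (con (+ 1) :+ m) :* a) refl (fromℕ R i) (f (suc i))))) refl ⟩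
    conv (suc N) (λ i → fromℕ R i * f i) g + conv (suc N) f (λ j → fromℕ R j * g j)  ∎
    where
    n  = fromℕ R N
    cv = conv N (f ∘ suc) g
    A  = conv N (λ i → fromℕ R i * f (suc i)) g
    B  = conv N (f ∘ suc) (λ j → fromℕ R j * g j)

  conv-leibniz-suc : ∀ N f g →
    fromℕ R (suc N) * conv (suc N) f g
      ≈ conv N (λ i → fromℕ R (suc i) * f (suc i)) g + conv N f (λ j → fromℕ R (suc j) * g (suc j))
  conv-leibniz-suc N f g = begin
    fromℕ R (suc N) * conv (suc N) f g
      ≈⟨ conv-leibniz (suc N) f g ⟩
    0# * f 0 * g (suc N) + A + conv (suc N) f (λ j → fromℕ R j * g j)
      ≈⟨ +-cong refl (conv-sucʳ N f (λ j → fromℕ R j * g j)) ⟩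
    0# * f 0 * g (suc N) + A + (B + f (suc N) * (0# * g 0))
      ≈⟨ solve 6 (λ a b c d A B → con (+ 0) :* a :* b :+ A :+ (B :+ c :* (con (+ 0) :* d)) := A :+ B) refl (f 0) (g (suc N)) (f (suc N)) (g 0) A B ⟩
    A + B ∎
    where
    A = conv N (λ i → fromℕ R (suc i) * f (suc i)) g
    B = conv N f (λ j → fromℕ R (suc j) * g (suc j))

  sumTo-conv : ∀ N f g → sumTo R N (λ k → f k * g (N ∸ k)) ≈ conv N f g
  sumTo-conv zero    f g = refl
  sumTo-conv (suc N) f g = begin
    sumTo R N (λ k → f k * g (suc N ∸ k)) + f (suc N) * g (N ∸ N)
      ≈⟨ +-cong (sumTo-congᵇ N (λ k k≤N → *-cong refl (reflexive (≡.cong g (ℕₚ.+-∸-assoc 1 k≤N)))))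
                (*-cong refl (reflexive (≡.cong g (ℕₚ.n∸n≡0 N)))) ⟩
    sumTo R N (λ k → f k * g (suc (N ∸ k))) + f (suc N) * g 0   ≈⟨ +-cong (sumTo-conv N f (g ∘ suc)) refl ⟩
    conv N f (g ∘ suc) + f (suc N) * g 0                        ≈⟨ conv-sucʳ N f g ⟨
    conv (suc N) f g                                            ∎

module Binomials {c ℓ} (R : CommutativeRing c ℓ) (F : FactorialInverses R) where
  open CommutativeRing R
  open FactorialInverses F
  open IntegerCoefficients R
  open Convolution R
  open import Algebra.Properties.Ring ring using (-1*x≈-x)
  open import Relation.Binary.Reasoning.Setoid setoid

  [_] : ℕ → Carrier
  [ n ] = fromℕ R n

  C : Carrier → ℕ → Carrier
  C = binom R F

  ε : ℕ → Carrier
  ε = sgn R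

  infixr 8 _^_
  _^_ : Carrier → ℕ → Carrier
  _^_ = pow R

  inv-zero : inv 0 ≈ 1#
  inv-zero = begin
    inv 0            ≈⟨ *-identityʳ (inv 0) ⟨
    inv 0 * 1#       ≈⟨ *-cong refl (+-identityʳ 1#) ⟨
    inv 0 * [ 0 ! ]  ≈⟨ inv-correct 0 ⟩
    1#               ∎

  inv-suc : ∀ k → inv (suc k) * [ suc k ] ≈ inv k
  inv-suc k = begin
    inv (suc k) * [ suc k ]                          ≈⟨ *-identityʳ _ ⟨
    inv (suc k) * [ suc k ] * 1#                     ≈⟨ *-cong refl (inv-correct k) ⟨
    inv (suc k) * [ suc k ] * (inv k * [ k ! ])
      ≈⟨ solve 4 (λ i n j f → i :* n :* (j :* f) := i :* (n :* f) :* j) refl (inv (suc k)) [ suc k ] (inv k) [ k ! ] ⟩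
    inv (suc k) * ([ suc k ] * [ k ! ]) * inv k      ≈⟨ *-cong (*-cong refl (fromℕ-* (suc k) (k !))) refl ⟨
    inv (suc k) * [ suc k ! ] * inv k                ≈⟨ *-cong (inv-correct (suc k)) refl ⟩
    1# * inv k                                       ≈⟨ *-identityˡ _ ⟩
    inv k                                            ∎

  [suc]-*-cancelˡ : ∀ m {u v} → [ suc m ] * u ≈ [ suc m ] * v → u ≈ v
  [suc]-*-cancelˡ m {u} {v} eq = begin
    u                                    ≈⟨ *-identityˡ u ⟨
    1# * u                               ≈⟨ *-cong left-inverse refl ⟨
    inv (suc m) * [ m ! ] * [ suc m ] * u
      ≈⟨ solve 4 (λ i f n u → i :* f :* n :* u := i :* f :* (n :* u)) refl (inv (suc m)) [ m ! ] [ suc m ] u ⟩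
    inv (suc m) * [ m ! ] * ([ suc m ] * u)  ≈⟨ *-cong refl eq ⟩
    inv (suc m) * [ m ! ] * ([ suc m ] * v)
      ≈⟨ solve 4 (λ i f n v → i :* f :* (n :* v) := i :* f :* n :* v) refl (inv (suc m)) [ m ! ] [ suc m ] v ⟩
    inv (suc m) * [ m ! ] * [ suc m ] * v    ≈⟨ *-cong left-inverse refl ⟩
    1# * v                               ≈⟨ *-identityˡ v ⟩
    v                                    ∎
    where
    left-inverse : inv (suc m) * [ m ! ] * [ suc m ] ≈ 1#
    left-inverse = begin
      inv (suc m) * [ m ! ] * [ suc m ]
        ≈⟨ solve 3 (λ i f n → i :* f :* n := i :* (n :* f)) refl (inv (suc m)) [ m ! ] [ suc m ] ⟩
      inv (suc m) * ([ suc m ] * [ m ! ])  ≈⟨ *-cong refl (fromℕ-* (suc m) (m !)) ⟨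
      inv (suc m) * [ suc m ! ]            ≈⟨ inv-correct (suc m) ⟩
      1#                                   ∎

  falling-suc : ∀ k {w v} → w ≈ 1# + v → falling R w (suc k) ≈ w * falling R v k
  falling-suc zero    {w} {v} _ = solve 1 (λ w → con (+ 1) :* (w :- con (+ 0)) := w :* con (+ 1)) refl w
  falling-suc (suc k) {w} {v} w≈1+v = begin
    falling R w (suc k) * (w - [ suc k ])             ≈⟨ *-cong (falling-suc k w≈1+v) (+-cong w≈1+v refl) ⟩
    w * falling R v k * ((1# + v) - (1# + [ k ]))
      ≈⟨ solve 4 (λ w f v n → w :* f :* ((con (+ 1) :+ v) :- (con (+ 1) :+ n)) := w :* (f :* (v :- n))) refl w (falling R v k) v [ k ] ⟩
    w * (falling R v k * (v - [ k ]))                 ∎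

  binom-zero : ∀ w → C w 0 ≈ 1#
  binom-zero w = trans (*-identityˡ _) inv-zero

  binom-absorb : ∀ k {w v} → w ≈ 1# + v → [ suc k ] * C w (suc k) ≈ w * C v k
  binom-absorb k {w} {v} w≈1+v = begin
    [ suc k ] * (falling R w (suc k) * inv (suc k))  ≈⟨ *-cong refl (*-cong (falling-suc k w≈1+v) refl) ⟩
    [ suc k ] * (w * falling R v k * inv (suc k))
      ≈⟨ solve 4 (λ n w f i → n :* (w :* f :* i) := w :* f :* (i :* n)) refl [ suc k ] w (falling R v k) (inv (suc k)) ⟩
    w * falling R v k * (inv (suc k) * [ suc k ])    ≈⟨ *-cong refl (inv-suc k) ⟩
    w * falling R v k * inv k                        ≈⟨ *-assoc _ _ _ ⟩
    w * C v k                                        ∎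

  binom-pascal : ∀ k {w v} → w ≈ 1# + v → C w (suc k) ≈ C v k + C v (suc k)
  binom-pascal k {w} {v} w≈1+v = begin
    falling R w (suc k) * inv (suc k)            ≈⟨ *-cong (trans (falling-suc k w≈1+v) (*-cong w≈1+v refl)) refl ⟩
    (1# + v) * falling R v k * inv (suc k)
      ≈⟨ solve 4 (λ v f i n → (con (+ 1) :+ v) :* f :* i := f :* (i :* (con (+ 1) :+ n)) :+ f :* (v :- n) :* i) refl v (falling R v k) (inv (suc k)) [ k ] ⟩
    falling R v k * (inv (suc k) * [ suc k ]) + falling R v (suc k) * inv (suc k)
                                                 ≈⟨ +-cong (*-cong refl (inv-suc k)) refl ⟩
    C v k + C v (suc k)                          ∎

  binom-fromℕ-suc : ∀ k → C [ k ] (suc k) ≈ 0#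
  binom-fromℕ-suc k = begin
    falling R [ k ] k * ([ k ] - [ k ]) * inv (suc k)  ≈⟨ *-cong (*-cong refl (-‿inverseʳ [ k ])) refl ⟩
    falling R [ k ] k * 0# * inv (suc k)              ≈⟨ solve 2 (λ f i → f :* con (+ 0) :* i := con (+ 0)) refl (falling R [ k ] k) (inv (suc k)) ⟩
    0#                                                ∎

  conv-binom-suc : ∀ m (h g : ℕ → Carrier) →
    conv (suc m) (λ l → C [ suc m ] l * h l) g
      ≈ conv m (λ l → C [ m ] l * h l) (g ∘ suc) + conv m (λ l → C [ m ] l * h (suc l)) g
  conv-binom-suc m h g = begin
    conv (suc m) (λ l → C [ suc m ] l * h l) g
      ≈⟨ conv-splitˡ m {f = λ l → C [ suc m ] l * h l} {f′ = λ l → C [ m ] l * h l} g refl pascal ⟩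
    conv (suc m) (λ l → C [ m ] l * h l) g + conv m (λ l → C [ m ] l * h (suc l)) g
      ≈⟨ +-cong (conv-sucʳ m (λ l → C [ m ] l * h l) g) refl ⟩
    conv m (λ l → C [ m ] l * h l) (g ∘ suc) + C [ m ] (suc m) * h (suc m) * g 0 + conv m (λ l → C [ m ] l * h (suc l)) g
      ≈⟨ +-cong (+-cong refl (*-cong (*-cong (binom-fromℕ-suc m) refl) refl)) refl ⟩
    conv m (λ l → C [ m ] l * h l) (g ∘ suc) + 0# * h (suc m) * g 0 + conv m (λ l → C [ m ] l * h (suc l)) g
      ≈⟨ +-cong (solve 3 (λ a b c → a :+ con (+ 0) :* b :* c := a) refl _ (h (suc m)) (g 0)) refl ⟩
    conv m (λ l → C [ m ] l * h l) (g ∘ suc) + conv m (λ l → C [ m ] l * h (suc l)) g ∎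
    where
    pascal : ∀ l → C [ suc m ] (suc l) * h (suc l) ≈ C [ m ] (suc l) * h (suc l) + C [ m ] l * h (suc l)
    pascal l = begin
      C [ suc m ] (suc l) * h (suc l)                            ≈⟨ *-cong (binom-pascal l refl) refl ⟩
      (C [ m ] l + C [ m ] (suc l)) * h (suc l)                  ≈⟨ distribʳ _ _ _ ⟩
      C [ m ] l * h (suc l) + C [ m ] (suc l) * h (suc l)        ≈⟨ +-comm _ _ ⟩
      C [ m ] (suc l) * h (suc l) + C [ m ] l * h (suc l)        ∎

  Apoly≈conv : ∀ b k u → Apoly R F b k u ≈ conv k (λ l → C [ k ] l * (ε l * b l)) (u ^_)
  Apoly≈conv b k u = trans (sumTo-conv k (λ l → C [ k ] l * ε l * b l) (u ^_)) (conv-congˡ k (u ^_) (λ l → *-assoc _ _ _))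

  Apoly-zero : ∀ b u → Apoly R F b 0 u ≈ b 0
  Apoly-zero b u = trans (*-cong (*-cong (*-cong (binom-zero [ 0 ]) refl) refl) refl)
                         (solve 1 (λ b → con (+ 1) :* con (+ 1) :* b :* con (+ 1) := b) refl (b 0))

  Apoly-suc : ∀ b m u → Apoly R F b (suc m) u ≈ u * Apoly R F b m u - Apoly R F (b ∘ suc) m u
  Apoly-suc b m u = begin
    Apoly R F b (suc m) u
      ≈⟨ Apoly≈conv b (suc m) u ⟩
    conv (suc m) (λ l → C [ suc m ] l * (ε l * b l)) (u ^_)
      ≈⟨ conv-binom-suc m (λ l → ε l * b l) (u ^_) ⟩
    conv m (λ l → C [ m ] l * (ε l * b l)) (λ j → u ^ j * u) + conv m (λ l → C [ m ] l * (- ε l * b (suc l))) (u ^_)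
      ≈⟨ +-cong (conv-congʳ m _ (λ j → *-comm (u ^ j) u))
                (conv-congˡ m (u ^_) (λ l → solve 3 (λ c s b → c :* (:- s :* b) := :- (c :* (s :* b))) refl (C [ m ] l) (ε l) (b (suc l)))) ⟩
    conv m (λ l → C [ m ] l * (ε l * b l)) (λ j → u * u ^ j) + conv m (λ l → - (C [ m ] l * (ε l * b (suc l)))) (u ^_)
      ≈⟨ +-cong (conv-*ʳ m u _ (u ^_)) (conv-negˡ m _ (u ^_)) ⟩
    u * conv m (λ l → C [ m ] l * (ε l * b l)) (u ^_) - conv m (λ l → C [ m ] l * (ε l * b (suc l))) (u ^_)
      ≈⟨ +-cong (*-cong refl (Apoly≈conv b m u)) (-‿cong (Apoly≈conv (b ∘ suc) m u)) ⟨
    u * Apoly R F b m u - Apoly R F (b ∘ suc) m u ∎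

  Apoly-cong : ∀ k u {b b′} → (∀ l → b l ≈ b′ l) → Apoly R F b k u ≈ Apoly R F b′ k u
  Apoly-cong k u b≈b′ = sumTo-cong k (λ l → *-cong (*-cong refl (b≈b′ l)) refl)

  Apoly-- : ∀ k u b b′ → Apoly R F (λ l → b l - b′ l) k u ≈ Apoly R F b k u - Apoly R F b′ k u
  Apoly-- k u b b′ = begin
    Apoly R F (λ l → b l - b′ l) k u
      ≈⟨ sumTo-cong k (λ l → solve 5 (λ c s p q w → c :* s :* (p :- q) :* w := c :* s :* p :* w :+ :- con (+ 1) :* (c :* s :* q :* w)) refl
                                       (C [ k ] l) (ε l) (b l) (b′ l) (u ^ (k ∸ l))) ⟩
    sumTo R k (λ l → C [ k ] l * ε l * b l * u ^ (k ∸ l) + - 1# * (C [ k ] l * ε l * b′ l * u ^ (k ∸ l)))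
      ≈⟨ sumTo-+ k _ _ ⟩
    Apoly R F b k u + sumTo R k (λ l → - 1# * (C [ k ] l * ε l * b′ l * u ^ (k ∸ l)))
      ≈⟨ +-cong refl (trans (sumTo-*ˡ k (- 1#) _) (-1*x≈-x _)) ⟩
    Apoly R F b k u - Apoly R F b′ k u ∎

  1#^n≈1# : ∀ n → 1# ^ n ≈ 1#
  1#^n≈1# zero    = refl
  1#^n≈1# (suc n) = trans (*-identityʳ _) (1#^n≈1# n)

  aStar≈Apoly-1# : ∀ b l → aStar R F b l ≈ Apoly R F b l 1#
  aStar≈Apoly-1# b l = sumTo-cong l (λ j → trans (sym (*-identityʳ _)) (*-cong refl (sym (1#^n≈1# (l ∸ j)))))

  aStar-suc : ∀ b l → aStar R F b (suc l) ≈ aStar R F b l - aStar R F (b ∘ suc) l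
  aStar-suc b l = begin
    aStar R F b (suc l)                                 ≈⟨ aStar≈Apoly-1# b (suc l) ⟩
    Apoly R F b (suc l) 1#                              ≈⟨ Apoly-suc b l 1# ⟩
    1# * Apoly R F b l 1# - Apoly R F (b ∘ suc) l 1#    ≈⟨ +-cong (*-identityˡ _) refl ⟩
    Apoly R F b l 1# - Apoly R F (b ∘ suc) l 1#         ≈⟨ +-cong (aStar≈Apoly-1# b l) (-‿cong (aStar≈Apoly-1# (b ∘ suc) l)) ⟨
    aStar R F b l - aStar R F (b ∘ suc) l               ∎

  aStar-zero : ∀ b → aStar R F b 0 ≈ b 0
  aStar-zero b = trans (aStar≈Apoly-1# b 0) (Apoly-zero b 1#)

  signedA : (ℕ → Carrier) → Carrier → ℕ → Carrier
  signedA b u m = ε m * Apoly R F b m u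

  signedA-zero : ∀ b u → signedA b u 0 ≈ b 0
  signedA-zero b u = trans (*-identityˡ _) (Apoly-zero b u)

  signedA-suc : ∀ b u m → signedA b u (suc m) ≈ (- u) * signedA b u m + signedA (b ∘ suc) u m
  signedA-suc b u m = begin
    - ε m * Apoly R F b (suc m) u                                 ≈⟨ *-cong refl (Apoly-suc b m u) ⟩
    - ε m * (u * Apoly R F b m u - Apoly R F (b ∘ suc) m u)
      ≈⟨ solve 4 (λ e u A A′ → :- e :* (u :* A :- A′) := :- u :* (e :* A) :+ e :* A′) refl (ε m) u (Apoly R F b m u) (Apoly R F (b ∘ suc) m u) ⟩
    (- u) * signedA b u m + signedA (b ∘ suc) u m                 ∎

  signedAStar-suc : ∀ b u m →
    signedA (aStar R F b) u (suc m) ≈ (1# - u) * signedA (aStar R F b) u m - signedA (aStar R F (b ∘ suc)) u m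
  signedAStar-suc b u m = begin
    signedA (aStar R F b) u (suc m)
      ≈⟨ signedA-suc (aStar R F b) u m ⟩
    (- u) * (ε m * A) + ε m * Apoly R F (aStar R F b ∘ suc) m u
      ≈⟨ +-cong refl (*-cong refl (trans (Apoly-cong m u (aStar-suc b)) (Apoly-- m u (aStar R F b) (aStar R F (b ∘ suc))))) ⟩
    (- u) * (ε m * A) + ε m * (A - A′)
      ≈⟨ solve 4 (λ u e A A′ → :- u :* (e :* A) :+ e :* (A :- A′) := (con (+ 1) :- u) :* (e :* A) :- e :* A′) refl u (ε m) A A′ ⟩
    (1# - u) * signedA (aStar R F b) u m - signedA (aStar R F (b ∘ suc)) u m ∎
    where
    A  = Apoly R F (aStar R F b) m u
    A′ = Apoly R F (aStar R F (b ∘ suc)) m u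

  r≈1+[r-1] : ∀ r → r ≈ 1# + (r - 1#)
  r≈1+[r-1] = solve 1 (λ r → r := con (+ 1) :+ (r :- con (+ 1))) refl

  x≈y+z⇒x-y≈z : ∀ {u v w} → u ≈ v + w → u - v ≈ w
  x≈y+z⇒x-y≈z {u} {v} {w} u≈v+w = trans (+-cong u≈v+w refl) (solve 2 (λ v w → v :+ w :- v := w) refl v w)

  module BinomialConvolution (x : Carrier) where

    -- The coefficient of w^N in (Σ_m C r m h m w^m) (1 + x w)^s.
    B : ℕ → Carrier → Carrier → (ℕ → Carrier) → Carrier
    B N r s h = conv N (λ m → C r m * h m) (λ j → C s j * x ^ j)

    B-combination : ∀ N r s {h h₁ h₂} α β → (∀ m → h m ≈ α * h₁ m + β * h₂ m) →
                    B N r s h ≈ α * B N r s h₁ + β * B N r s h₂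
    B-combination N r s {h} {h₁} {h₂} α β h≈ = begin
      B N r s h
        ≈⟨ conv-congˡ N g (λ m → trans (*-cong refl (h≈ m))
             (solve 5 (λ c a b p q → c :* (a :* p :+ b :* q) := a :* (c :* p) :+ b :* (c :* q)) refl (C r m) α β (h₁ m) (h₂ m))) ⟩
      conv N (λ m → α * (C r m * h₁ m) + β * (C r m * h₂ m)) g
        ≈⟨ conv-+ˡ N _ _ g ⟩
      conv N (λ m → α * (C r m * h₁ m)) g + conv N (λ m → β * (C r m * h₂ m)) g
        ≈⟨ +-cong (conv-*ˡ N α _ g) (conv-*ˡ N β _ g) ⟩
      α * B N r s h₁ + β * B N r s h₂ ∎
      where
      g : ℕ → Carrier
      g j = C s j * x ^ j

    B-pascalˡ : ∀ N r s h → B (suc N) r s h ≈ B (suc N) (r - 1#) s h + B N (r - 1#) s (h ∘ suc)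
    B-pascalˡ N r s h = conv-splitˡ N {f = λ m → C r m * h m} {f′ = λ m → C (r - 1#) m * h m} _ refl pascal
      where
      pascal : ∀ m → C r (suc m) * h (suc m) ≈ C (r - 1#) (suc m) * h (suc m) + C (r - 1#) m * h (suc m)
      pascal m = trans (*-cong (binom-pascal m (r≈1+[r-1] r)) refl) (trans (distribʳ _ _ _) (+-comm _ _))

    B-pascalʳ : ∀ N r s h → B (suc N) r s h ≈ B (suc N) r (s - 1#) h + x * B N r (s - 1#) h
    B-pascalʳ N r s h = trans (conv-splitʳ N _ refl pascal) (+-cong refl (conv-*ʳ N x _ _))
      where
      pascal : ∀ j → C s (suc j) * x ^ suc j ≈ C (s - 1#) (suc j) * x ^ suc j + x * (C (s - 1#) j * x ^ j)
      pascal j = trans (*-cong (binom-pascal j (r≈1+[r-1] s)) refl)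
        (solve 4 (λ c d p x → (c :+ d) :* (p :* x) := d :* (p :* x) :+ x :* (c :* p)) refl (C (s - 1#) j) (C (s - 1#) (suc j)) (x ^ j) x)

    B-leibniz : ∀ N r s h → [ suc N ] * B (suc N) r s h ≈ r * B N (r - 1#) s (h ∘ suc) + s * (x * B N r (s - 1#) h)
    B-leibniz N r s h = begin
      [ suc N ] * B (suc N) r s h
        ≈⟨ conv-leibniz-suc N _ _ ⟩
      conv N (λ m → [ suc m ] * (C r (suc m) * h (suc m))) g + conv N (λ m → C r m * h m) (λ j → [ suc j ] * (C s (suc j) * x ^ suc j))
        ≈⟨ +-cong (conv-congˡ N g absorbˡ) (conv-congʳ N _ absorbʳ) ⟩
      conv N (λ m → r * (C (r - 1#) m * h (suc m))) g + conv N (λ m → C r m * h m) (λ j → s * x * (C (s - 1#) j * x ^ j))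
        ≈⟨ +-cong (conv-*ˡ N r _ g) (trans (conv-*ʳ N (s * x) _ _) (*-assoc s x _)) ⟩
      r * B N (r - 1#) s (h ∘ suc) + s * (x * B N r (s - 1#) h) ∎
      where
      g : ℕ → Carrier
      g j = C s j * x ^ j
      absorbˡ : ∀ m → [ suc m ] * (C r (suc m) * h (suc m)) ≈ r * (C (r - 1#) m * h (suc m))
      absorbˡ m = trans (sym (*-assoc _ _ _)) (trans (*-cong (binom-absorb m (r≈1+[r-1] r)) refl) (*-assoc _ _ _))
      absorbʳ : ∀ j → [ suc j ] * (C s (suc j) * x ^ suc j) ≈ s * x * (C (s - 1#) j * x ^ j)
      absorbʳ j = begin
        [ suc j ] * (C s (suc j) * (x ^ j * x))
          ≈⟨ solve 4 (λ n c p x → n :* (c :* (p :* x)) := n :* c :* (p :* x)) refl [ suc j ] (C s (suc j)) (x ^ j) x ⟩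
        [ suc j ] * C s (suc j) * (x ^ j * x)   ≈⟨ *-cong (binom-absorb j (r≈1+[r-1] s)) refl ⟩
        s * C (s - 1#) j * (x ^ j * x)
          ≈⟨ solve 4 (λ s c p x → s :* c :* (p :* x) := s :* x :* (c :* p)) refl s (C (s - 1#) j) (x ^ j) x ⟩
        s * x * (C (s - 1#) j * x ^ j)          ∎

    B-euler : ∀ N r s h → [ N ] * B N r s h ≈ r * (B N r s h - B N (r - 1#) s h) + s * (B N r s h - B N r (s - 1#) h)
    B-euler zero    r s h = solve 3 (λ r s b → con (+ 0) :* b := r :* (b :- b) :+ s :* (b :- b)) refl r s (B 0 r s h)
    B-euler (suc N) r s h = begin
      [ suc N ] * B (suc N) r s h
        ≈⟨ B-leibniz N r s h ⟩
      r * B N (r - 1#) s (h ∘ suc) + s * (x * B N r (s - 1#) h)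
        ≈⟨ +-cong (*-cong refl (x≈y+z⇒x-y≈z (B-pascalˡ N r s h))) (*-cong refl (x≈y+z⇒x-y≈z (B-pascalʳ N r s h))) ⟨
      r * (B (suc N) r s h - B (suc N) (r - 1#) s h) + s * (B (suc N) r s h - B (suc N) r (s - 1#) h) ∎

  module _ (x y : Carrier) {a} {A : Set a} (E : A → A) (p q : A → ℕ → Carrier)
           (p-suc    : ∀ α m → p α (suc m) ≈ (- y) * p α m + p (E α) m)
           (q-suc    : ∀ α m → q α (suc m) ≈ (x + y) * q α m - q (E α) m)
           (p≈q-zero : ∀ α → p α 0 ≈ q α 0) where
    open BinomialConvolution x

    B-p≈ε*B-q : ∀ N r s t α → r + s + t ≈ [ N ] - 1# → B N r s (p α) ≈ ε N * B N r t (q α)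
    B-p≈ε*B-q zero    r s t α _ = trans (*-cong (*-cong refl (p≈q-zero α)) refl) (sym (*-identityˡ _))
    B-p≈ε*B-q (suc M) r s t α r+s+t≈M = [suc]-*-cancelˡ M (begin
      [ suc M ] * B (suc M) r s (p α)
        ≈⟨ B-leibniz M r s (p α) ⟩
      r * B M (r - 1#) s (p α ∘ suc) + s * (x * B M r (s - 1#) (p α))
        ≈⟨ +-cong (*-cong refl (B-combination M (r - 1#) s (- y) 1# (λ m → trans (p-suc α m) (+-cong refl (sym (*-identityˡ _)))))) refl ⟩
      r * ((- y) * B M (r - 1#) s (p α) + 1# * B M (r - 1#) s (p (E α))) + s * (x * B M r (s - 1#) (p α))
        ≈⟨ +-cong (*-cong refl (+-cong (*-cong refl (B-p≈ε*B-q M (r - 1#) s t α r-1+s+t≈M-1))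
                                       (*-cong refl (B-p≈ε*B-q M (r - 1#) s t (E α) r-1+s+t≈M-1))))
                  (*-cong s≈M-r-t (*-cong refl (B-p≈ε*B-q M r (s - 1#) t α r+s-1+t≈M-1))) ⟩
      r * ((- y) * (σ * S₁) + 1# * (σ * S₂)) + (m - r - t) * (x * (σ * S₃))
        ≈⟨ solve 10 (λ r y σ S₁ S₂ m t x S₃ S₄ →
             r :* (:- y :* (σ :* S₁) :+ con (+ 1) :* (σ :* S₂)) :+ (m :- r :- t) :* (x :* (σ :* S₃))
             := :- σ :* (r :* ((x :+ y) :* S₁ :+ :- con (+ 1) :* S₂) :+ t :* (x :* S₄))
                :+ σ :* x :* (m :* S₃ :- (r :* (S₃ :- S₁) :+ t :* (S₃ :- S₄))))
             refl r y σ S₁ S₂ m t x S₃ S₄ ⟩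
      - σ * T + σ * x * (m * S₃ - (r * (S₃ - S₁) + t * (S₃ - S₄)))
        ≈⟨ +-cong refl (*-cong refl (+-cong (B-euler M r t (q α)) refl)) ⟩
      - σ * T + σ * x * (W - W)
        ≈⟨ solve 3 (λ a c w → a :+ c :* (w :- w) := a) refl (- σ * T) (σ * x) W ⟩
      - σ * T
        ≈⟨ *-cong refl (+-cong (*-cong refl (B-combination M (r - 1#) t (x + y) (- 1#) q-combination)) refl) ⟨
      - σ * (r * B M (r - 1#) t (q α ∘ suc) + t * (x * S₄))
        ≈⟨ *-cong refl (B-leibniz M r t (q α)) ⟨
      - σ * ([ suc M ] * B (suc M) r t (q α))
        ≈⟨ solve 3 (λ σ n b → :- σ :* (n :* b) := n :* (:- σ :* b)) refl σ [ suc M ] (B (suc M) r t (q α)) ⟩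
      [ suc M ] * (ε (suc M) * B (suc M) r t (q α)) ∎)
      where
      m  = [ M ]
      σ  = ε M
      S₁ = B M (r - 1#) t (q α)
      S₂ = B M (r - 1#) t (q (E α))
      S₃ = B M r t (q α)
      S₄ = B M r (t - 1#) (q α)
      T  = r * ((x + y) * S₁ + (- 1#) * S₂) + t * (x * S₄)
      W  = r * (S₃ - S₁) + t * (S₃ - S₄)
      q-combination : ∀ k → q α (suc k) ≈ (x + y) * q α k + (- 1#) * q (E α) k
      q-combination k = trans (q-suc α k) (+-cong refl (sym (-1*x≈-x _)))
      r+s+t-1≈M-1 : r + s + t - 1# ≈ m - 1#
      r+s+t-1≈M-1 = trans (+-cong r+s+t≈M refl) (solve 1 (λ m → con (+ 1) :+ m :- con (+ 1) :- con (+ 1) := m :- con (+ 1)) refl m)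
      r-1+s+t≈M-1 : r - 1# + s + t ≈ m - 1#
      r-1+s+t≈M-1 = trans (solve 3 (λ r s t → r :- con (+ 1) :+ s :+ t := r :+ s :+ t :- con (+ 1)) refl r s t) r+s+t-1≈M-1
      r+s-1+t≈M-1 : r + (s - 1#) + t ≈ m - 1#
      r+s-1+t≈M-1 = trans (solve 3 (λ r s t → r :+ (s :- con (+ 1)) :+ t := r :+ s :+ t :- con (+ 1)) refl r s t) r+s+t-1≈M-1
      s≈M-r-t : s ≈ m - r - t
      s≈M-r-t = begin
        s                            ≈⟨ solve 3 (λ r s t → s := r :+ s :+ t :- con (+ 1) :+ con (+ 1) :- r :- t) refl r s t ⟩
        r + s + t - 1# + 1# - r - t  ≈⟨ +-cong (+-cong (+-cong r+s+t-1≈M-1 refl) refl) refl ⟩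
        m - 1# + 1# - r - t          ≈⟨ solve 3 (λ m r t → m :- con (+ 1) :+ con (+ 1) :- r :- t := m :- r :- t) refl m r t ⟩
        m - r - t                    ∎

lemma2p2 : ∀ {c ℓ} (R : CommutativeRing c ℓ) (F : FactorialInverses R) →
    let open CommutativeRing R in
    (a : ℕ → Carrier) (n : ℕ) → n ≥ 1 →
    (r s t x y z : Carrier) →
    r + s + t ≈ fromℕ R n - 1# →
    x + y + z ≈ 1# →
    sumTo R n (λ k → sgn R k * binom R F r k * pow R x (n ∸ k)
      * (binom R F s (n ∸ k) * Apoly R F a k y
         - sgn R n * binom R F t (n ∸ k) * AStarPoly R F a k z))
      ≈ 0#
-- The identity holds for n = 0 as well.
lemma2p2 R F a n _ r s t x y z r+s+t≈n-1 x+y+z≈1 = begin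
  sumTo R n (λ k → ε k * C r k * x ^ (n ∸ k) * (C s (n ∸ k) * Apoly R F a k y - ε n * C t (n ∸ k) * AStarPoly R F a k z))
    ≈⟨ sumTo-cong n (λ k → solve 8 (λ e c X cs A en ct A* → e :* c :* X :* (cs :* A :- en :* ct :* A*)
                                      := c :* (e :* A) :* (cs :* X) :+ :- en :* (c :* (e :* A*) :* (ct :* X))) refl
                         (ε k) (C r k) (x ^ (n ∸ k)) (C s (n ∸ k)) (Apoly R F a k y) (ε n) (C t (n ∸ k)) (AStarPoly R F a k z)) ⟩
  sumTo R n (λ k → C r k * p a k * (C s (n ∸ k) * x ^ (n ∸ k)) + (- ε n) * (C r k * q a k * (C t (n ∸ k) * x ^ (n ∸ k))))
    ≈⟨ trans (sumTo-+ n _ _) (+-cong (sumTo-conv n _ _) (trans (sumTo-*ˡ n (- ε n) _) (*-cong refl (sumTo-conv n _ _)))) ⟩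
  B n r s (p a) + (- ε n) * B n r t (q a)
    ≈⟨ +-cong (B-p≈ε*B-q x y (_∘ suc) p q (λ b → signedA-suc b y) q-suc p≈q-zero n r s t a r+s+t≈n-1) refl ⟩
  ε n * B n r t (q a) + (- ε n) * B n r t (q a)
    ≈⟨ solve 2 (λ e b → e :* b :+ :- e :* b := con (+ 0)) refl (ε n) (B n r t (q a)) ⟩
  0# ∎
  where
  open CommutativeRing R
  open IntegerCoefficients R using (solve; _:=_; _:+_; _:*_; :-_; _:-_; con)
  open Convolution R
  open Binomials R F
  open BinomialConvolution x
  open import Relation.Binary.Reasoning.Setoid setoid

  p q : (ℕ → Carrier) → ℕ → Carrier
  p b = signedA b y
  q b = signedA (aStar R F b) z

  q-suc : ∀ b m → q b (suc m) ≈ (x + y) * q b m - q (b ∘ suc) m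
  q-suc b m = trans (signedAStar-suc b z m) (+-cong (*-cong 1-z≈x+y refl) refl)
    where
    1-z≈x+y : 1# - z ≈ x + y
    1-z≈x+y = trans (+-cong (sym x+y+z≈1) refl) (solve 3 (λ x y z → x :+ y :+ z :- z := x :+ y) refl x y z)

  p≈q-zero : ∀ b → p b 0 ≈ q b 0
  p≈q-zero b = trans (signedA-zero b y) (sym (trans (signedA-zero (aStar R F b) z) (aStar-zero b)))
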